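{- Let $n\ge 2$ be an integer. Construct the graph $G=(V,E)$ with weights $c=(c_1,c_2)\colon E\to\mathbb{Z}\times\mathbb{N}_+$ as follows: for each $i\in[n]$ create vertices $v_i,v_i',w_i$ and edges $\{v_i,w_i\}$ with weight $(2^i,2^i)^\mathsf{T}$, $\{v_i,v_i'\}$ with weight $(0,2^i)^\mathsf{T}$ and $\{v_i',w_i\}$ with weight $(0,2^i)^\mathsf{T}$; for each $i\in[n-1]$ add the edge $\{w_i,v_{i+1}\}$ with weight $(0,1)^\mathsf{T}$; set $s:=v_1$, $t:=w_n$ and add the edge $\{s,t\}$ with weight $(2^{n+1},1)^\mathsf{T}$. Let $X$ be the set of all spanners $S$ of $G$ that contain every edge $e\in E$ with $c_1(e)=0$ and do not contain $\{s,t\}$. Then for all $S,S'\in X$ with $S\neq S'$, the value vectors $f(S)$ and $f(S')$ are different and neither of $S,S'$ dominates the other.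
   Context: $[n]=\{1,\dots,n\}$. A spanner of a connected undirected graph $G=(V,E)$ is a set $S\subseteq E$ such that $(V,S)$ is connected. Its value vector is $f(S)=(f_1(S),f_2(S))^\mathsf{T}$ with $f_1(S)=\sum_{e\in S}c_1(e)$ and $f_2(S)=\max_{u,v\in V,\,u\neq v}\frac{d^S_{c_2}(u,v)}{d^E_{c_2}(u,v)}$, where $d^F_{c_2}(u,v)$ is the $c_2$-length of a shortest $u$-$v$-path in $(V,F)$. $S$ dominates $S'$ if $f(S)\neq f(S')$ and $f(S)\le f(S')$ componentwise. -}

module Defs where

open import Data.Nat as ℕ using (ℕ; zero; suc; _+_; _^_; _*_)
open import Data.Integer as ℤ using (ℤ; +_)
open import Data.Rational as ℚ using (ℚ; 0ℚ)
open import Data.Fin using (Fin; zero; suc; toℕ; fromℕ; inject₁)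
open import Data.Fin.Properties using () renaming (_≟_ to _≟F_)
open import Data.Bool using (Bool; true; false; if_then_else_)
open import Data.List using (List; []; _∷_; _++_; map; foldr; filter; cartesianProduct; allFin; length)
open import Data.Maybe using (Maybe; just; nothing)
open import Data.Product using (_×_; _,_; proj₁; proj₂; Σ)
open import Data.Product.Properties using (≡-dec)
open import Relation.Binary.PropositionalEquality using (_≡_; _≢_; refl)
open import Relation.Nullary using (Dec; yes; no; ¬_)
open import Relation.Nullary.Decidable using (⌊_⌋)

-- The graph G_n.  Index j : Fin n stands for i = toℕ j + 1 ∈ [n].

data Kind : Set where
  vK v'K wK : Kind

_≟K_ : (a b : Kind) → Dec (a ≡ b)
vK  ≟K vK  = yes refl
vK  ≟K v'K = no λ ()
vK  ≟K wK  = no λ ()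
v'K ≟K vK  = no λ ()
v'K ≟K v'K = yes refl
v'K ≟K wK  = no λ ()
wK  ≟K vK  = no λ ()
wK  ≟K v'K = no λ ()
wK  ≟K wK  = yes refl

Vertex : ℕ → Set
Vertex n = Fin n × Kind

_≟V_ : {n : ℕ} (u v : Vertex n) → Dec (u ≡ v)
_≟V_ = ≡-dec _≟F_ _≟K_

allKinds : List Kind
allKinds = vK ∷ v'K ∷ wK ∷ []

allVertices : (n : ℕ) → List (Vertex n)
allVertices n = cartesianProduct (allFin n) allKinds

data Edge : ℕ → Set where
  vw  : {n : ℕ} → Fin n → Edge n
  vv' : {n : ℕ} → Fin n → Edge n
  v'w : {n : ℕ} → Fin n → Edge n
  wv  : {m : ℕ} → Fin m → Edge (suc m)
  st  : {m : ℕ} → Edge (suc m)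

ends : {n : ℕ} → Edge n → Vertex n × Vertex n
ends (vw j)  = (j , vK) , (j , wK)
ends (vv' j) = (j , vK) , (j , v'K)
ends (v'w j) = (j , v'K) , (j , wK)
ends (wv j)  = (inject₁ j , wK) , (suc j , vK)
ends {suc m} st = (zero , vK) , (fromℕ m , wK)

allEdges : (n : ℕ) → List (Edge n)
allEdges zero = []
allEdges (suc m) =
  map vw (allFin (suc m)) ++ map vv' (allFin (suc m)) ++ map v'w (allFin (suc m))
  ++ map wv (allFin m) ++ (st ∷ [])

pow : {n : ℕ} → Fin n → ℕ
pow j = 2 ^ suc (toℕ j)

c₁ : {n : ℕ} → Edge n → ℤ
c₁ (vw j)  = + pow j
c₁ (vv' j) = + 0
c₁ (v'w j) = + 0
c₁ (wv j)  = + 0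
c₁ {suc m} st = + (2 ^ (suc m + 1))

c₂ : {n : ℕ} → Edge n → ℕ
c₂ (vw j)  = pow j
c₂ (vv' j) = pow j
c₂ (v'w j) = pow j
c₂ (wv j)  = 1
c₂ st      = 1

isST : {n : ℕ} → Edge n → Bool
isST st = true
isST _  = false

EdgeSet : ℕ → Set
EdgeSet n = Edge n → Bool

fullE : {n : ℕ} → EdgeSet n
fullE _ = true

data Reach {n : ℕ} (F : EdgeSet n) : Vertex n → Vertex n → Set where
  here  : {u : Vertex n} → Reach F u u
  fwd   : {u : Vertex n} (e : Edge n) → F e ≡ true →
          Reach F u (proj₁ (ends e)) → Reach F u (proj₂ (ends e))
  bwd   : {u : Vertex n} (e : Edge n) → F e ≡ true →
          Reach F u (proj₂ (ends e)) → Reach F u (proj₁ (ends e))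

IsSpanner : {n : ℕ} → EdgeSet n → Set
IsSpanner {n} S = (u v : Vertex n) → Reach S u v

-- Shortest path distances d^F_{c₂}(u,v)  (nothing = no path)

minM : Maybe ℕ → Maybe ℕ → Maybe ℕ
minM nothing  y        = y
minM (just x) nothing  = just x
minM (just x) (just y) = just (x ℕ.⊓ y)

addM : Maybe ℕ → ℕ → Maybe ℕ
addM nothing  _ = nothing
addM (just x) c = just (x + c)

-- walkDist F k u v = minimal c₂-length of a u-v walk in (V,F) using at most k edges
walkDist : {n : ℕ} → EdgeSet n → ℕ → Vertex n → Vertex n → Maybe ℕ
walkDist F zero u v = if ⌊ u ≟V v ⌋ then just 0 else nothing
walkDist {n} F (suc k) u v = foldr step (walkDist F k u v) (allEdges n)
  where
  step : Edge n → Maybe ℕ → Maybe ℕ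
  step e acc with F e
  ... | false = acc
  ... | true  =
    minM acc
      (minM (if ⌊ proj₂ (ends e) ≟V v ⌋
               then addM (walkDist F k u (proj₁ (ends e))) (c₂ e) else nothing)
            (if ⌊ proj₁ (ends e) ≟V v ⌋
               then addM (walkDist F k u (proj₂ (ends e))) (c₂ e) else nothing))

-- shortest paths use at most |V| - 1 edges, so |V| = 3n edges suffice
dist : {n : ℕ} → EdgeSet n → Vertex n → Vertex n → Maybe ℕ
dist {n} F u v = walkDist F (3 * n) u v

f₁ : {n : ℕ} → EdgeSet n → ℤ
f₁ {n} S = foldr (λ e acc → if S e then c₁ e ℤ.+ acc else acc) (+ 0) (allEdges n)

-- ratio a/b (the b = 0 / no-path cases never occur for spanners and u ≠ v)
ratio : Maybe ℕ → Maybe ℕ → ℚ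
ratio (just a) (just (suc b)) = (+ a) ℚ./ suc b
ratio _        _              = 0ℚ

distinctPairs : (n : ℕ) → List (Vertex n × Vertex n)
distinctPairs n =
  filter (λ p → Relation.Nullary.¬? (proj₁ p ≟V proj₂ p))
         (cartesianProduct (allVertices n) (allVertices n))

-- max over u ≠ v of d^S(u,v)/d^E(u,v)   (all ratios are ≥ 1, so base 0 is harmless)
f₂ : {n : ℕ} → EdgeSet n → ℚ
f₂ {n} S = foldr (λ p acc → ratio (dist S (proj₁ p) (proj₂ p))
                                  (dist fullE (proj₁ p) (proj₂ p)) ℚ.⊔ acc)
                 0ℚ (distinctPairs n)

f : {n : ℕ} → EdgeSet n → ℤ × ℚ
f S = f₁ S , f₂ S

Dominates : {n : ℕ} → EdgeSet n → EdgeSet n → Set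
Dominates S S' = (f S ≢ f S') × (f₁ S ℤ.≤ f₁ S') × (f₂ S ℚ.≤ f₂ S')

InX : {n : ℕ} → EdgeSet n → Set
InX S = IsSpanner S
      × ((e : _) → c₁ e ≡ + 0 → S e ≡ true)
      × ((e : _) → isST e ≡ true → S e ≡ false)

{-# OPTIONS --safe #-}
-- For S ∈ X the only free choices are the edges {v_i, w_i}, so S is determined by the bits
-- b_i = [{v_i, w_i} ∈ S], and f₁(S) = Σ b_i 2^i is their binary value: distinct members of X
-- have distinct f₁. The s–t path of S crosses block i by {v_i, w_i} (length 2^i) when b_i = 1
-- and through v_i′ (length 2^(i+1)) otherwise, so its length L(S) satisfies
-- L(S) + f₁(S) = Σ_i 2^(i+1) + (n - 1) for every S ∈ X. Any two vertices are joined in S by a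
-- walk along this path of length at most L(S), the distance from s along the path is a
-- potential showing d^S(s,t) ≥ L(S), and d^E(s,t) = 1 through {s,t}; hence f₂(S) = L(S).
-- Thus f₁ and f₂ are strictly anti-monotone on X and no member of X dominates another.
module Submission where

open import Defs
open import Data.Nat using (ℕ; _≤_)
open import Data.Product using (_×_)
open import Relation.Binary.PropositionalEquality using (_≡_; _≢_)
open import Relation.Nullary using (¬_)

import Data.Nat.Properties as ℕ

open import Algebra.Properties.CommutativeMonoid.Sum ℕ.+-0-commutativeMonoid
  using (sum; ∑-distrib-+; sum-cong-≗)
open import Algebra.Properties.CommutativeSemigroup ℕ.+-commutativeSemigroup
  using (x∙yz≈y∙xz; xy∙z≈y∙xz)
open import Data.Bool using (Bool; true; false; if_then_else_)
open import Data.Empty using (⊥-elim)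
open import Data.Fin as Fin using (Fin; zero; suc; toℕ; fromℕ; inject₁)
open import Data.Fin.Induction using (<-weakInduction; <-weakInduction-startingFrom)
open import Data.Fin.Properties using (toℕ-injective; toℕ-inject₁; toℕ-fromℕ; ≤fromℕ)
import Data.Integer as ℤ
import Data.Integer.Properties as ℤ
open import Data.List using (List; []; _∷_; _++_; foldr; map; allFin; tabulate)
open import Data.List.Membership.Propositional using (_∈_)
open import Data.List.Membership.Propositional.Properties
  using (∈-++⁺ˡ; ∈-++⁺ʳ; ∈-map⁺; ∈-allFin; ∈-filter⁺; ∈-cartesianProduct⁺)
open import Data.List.Properties using (foldr-cong; foldr-++)
open import Data.List.Relation.Unary.Any using (here; there)
open import Data.Maybe using (Maybe; just; nothing)
open import Data.Maybe.Relation.Unary.All as All using (All; just; nothing)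
open import Data.Maybe.Relation.Unary.Any as Any using (Any; just)
open import Data.Nat using (zero; suc; _+_; _*_; _^_; _<_; z≤n; s≤s; s≤s⁻¹)
open import Data.Product using (Σ; _,_; proj₁; proj₂)
import Data.Rational as ℚ
import Data.Rational.Properties as ℚ
import Data.Rational.Unnormalised as ℚᵘ
import Data.Rational.Unnormalised.Properties as ℚᵘ
open import Data.Sum using (_⊎_; inj₁; inj₂; [_,_]′)
open import Data.Vec.Functional using (tail)
open import Relation.Binary.Definitions using (tri<; tri≈; tri>)
open import Relation.Binary.PropositionalEquality
  using (refl; sym; trans; cong; cong₂; subst; subst₂; module ≡-Reasoning)
open import Relation.Nullary using (yes; no; ¬?)
open import Relation.Nullary.Decidable using (⌊_⌋)

foldr-preserves : ∀ {A B : Set} {P : B → Set} {g : A → B → B} →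
                  (∀ x {y} → P y → P (g x y)) → ∀ {z} → P z → ∀ xs → P (foldr g z xs)
foldr-preserves pres Pz []       = Pz
foldr-preserves pres Pz (x ∷ xs) = pres x (foldr-preserves pres Pz xs)

foldr-preserves-from : ∀ {A B : Set} {P : B → Set} {g : A → B → B} {x : A} →
                       (∀ x {y} → P y → P (g x y)) → (∀ y → P (g x y)) →
                       ∀ {z xs} → x ∈ xs → P (foldr g z xs)
foldr-preserves-from pres Pgx (here refl)  = Pgx _
foldr-preserves-from pres Pgx (there x∈xs) = pres _ (foldr-preserves-from pres Pgx x∈xs)

-- Walks

module _ {n : ℕ} {F : EdgeSet n} where

  cost : (Edge n → ℕ) → {u v : Vertex n} → Reach F u v → ℕ
  cost c here        = 0
  cost c (fwd e _ p) = c e + cost c p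
  cost c (bwd e _ p) = c e + cost c p

  length weight : {u v : Vertex n} → Reach F u v → ℕ
  length = cost (λ _ → 1)
  weight = cost c₂

  _++ᴿ_ : {u x v : Vertex n} → Reach F u x → Reach F x v → Reach F u v
  p ++ᴿ here       = p
  p ++ᴿ fwd e Fe q = fwd e Fe (p ++ᴿ q)
  p ++ᴿ bwd e Fe q = bwd e Fe (p ++ᴿ q)

  cost-++ : (c : Edge n → ℕ) {u x v : Vertex n} (p : Reach F u x) (q : Reach F x v) →
            cost c (p ++ᴿ q) ≡ cost c p + cost c q
  cost-++ c p here        = sym (ℕ.+-identityʳ _)
  cost-++ c p (fwd e _ q) = trans (cong (c e +_) (cost-++ c p q)) (x∙yz≈y∙xz (c e) (cost c p) _)
  cost-++ c p (bwd e _ q) = trans (cong (c e +_) (cost-++ c p q)) (x∙yz≈y∙xz (c e) (cost c p) _)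

  cost-++-≤ : (c : Edge n → ℕ) {u x v : Vertex n} (p : Reach F u x) (q : Reach F x v) →
              ∀ {a b b′ d} → cost c p + a ≤ b → b ≤ b′ → cost c q + b′ ≤ d → cost c (p ++ᴿ q) + a ≤ d
  cost-++-≤ c p q {a} {b} {b′} {d} p-bound b≤b′ q-bound = begin
    cost c (p ++ᴿ q) + a       ≡⟨ cong (_+ a) (cost-++ c p q) ⟩
    cost c p + cost c q + a    ≡⟨ xy∙z≈y∙xz (cost c p) (cost c q) a ⟩
    cost c q + (cost c p + a)  ≤⟨ ℕ.+-monoʳ-≤ (cost c q) (ℕ.≤-trans p-bound b≤b′) ⟩
    cost c q + b′              ≤⟨ q-bound ⟩
    d                          ∎
    where open ℕ.≤-Reasoning

  reverse : {u v : Vertex n} → Reach F u v → Reach F v u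
  reverse here         = here
  reverse (fwd e Fe p) = bwd e Fe here ++ᴿ reverse p
  reverse (bwd e Fe p) = fwd e Fe here ++ᴿ reverse p

  cost-reverse : (c : Edge n → ℕ) {u v : Vertex n} (p : Reach F u v) → cost c (reverse p) ≡ cost c p
  cost-reverse c here         = refl
  cost-reverse c (fwd e Fe p) = begin
    cost c (bwd e Fe here ++ᴿ reverse p)  ≡⟨ cost-++ c (bwd e Fe here) (reverse p) ⟩
    (c e + 0) + cost c (reverse p)        ≡⟨ cong₂ _+_ (ℕ.+-identityʳ (c e)) (cost-reverse c p) ⟩
    c e + cost c p                        ∎
    where open ≡-Reasoning
  cost-reverse c (bwd e Fe p) = begin
    cost c (fwd e Fe here ++ᴿ reverse p)  ≡⟨ cost-++ c (fwd e Fe here) (reverse p) ⟩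
    (c e + 0) + cost c (reverse p)        ≡⟨ cong₂ _+_ (ℕ.+-identityʳ (c e)) (cost-reverse c p) ⟩
    c e + cost c p                        ∎
    where open ≡-Reasoning

-- Bellman–Ford distances

minM-anyˡ : ∀ {w x} y → Any (_≤ w) x → Any (_≤ w) (minM x y)
minM-anyˡ nothing  (just a≤w) = just a≤w
minM-anyˡ (just b) (just a≤w) = just (ℕ.≤-trans (ℕ.m⊓n≤m _ b) a≤w)

minM-anyʳ : ∀ {w} x {y} → Any (_≤ w) y → Any (_≤ w) (minM x y)
minM-anyʳ nothing  b≤w        = b≤w
minM-anyʳ (just a) (just b≤w) = just (ℕ.≤-trans (ℕ.m⊓n≤n a _) b≤w)

minM-all : ∀ {P : ℕ → Set} {x y} → All P x → All P y → All P (minM x y)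
minM-all nothing   Py      = Py
minM-all (just Pa) nothing = just Pa
minM-all {P} (just {a} Pa) (just {b} Pb) =
  just ([ (λ eq → subst P (sym eq) Pa) , (λ eq → subst P (sym eq) Pb) ]′ (ℕ.⊓-sel a b))

addM-any : ∀ {w x} c → Any (_≤ w) x → Any (_≤ c + w) (addM x c)
addM-any c (just {a} a≤w) = just (ℕ.≤-trans (ℕ.≤-reflexive (ℕ.+-comm a c)) (ℕ.+-monoʳ-≤ c a≤w))

addM-all : ∀ {P Q : ℕ → Set} {x} c → (∀ {a} → P a → Q (a + c)) → All P x → All Q (addM x c)
addM-all c P⇒Q nothing   = nothing
addM-all c P⇒Q (just Pa) = just (P⇒Q Pa)

squeeze : ∀ {w x} → Any (_≤ w) x → All (w ≤_) x → x ≡ just w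
squeeze (just a≤w) (just w≤a) = cong just (ℕ.≤-antisym a≤w w≤a)

Potential : {n : ℕ} → EdgeSet n → (Vertex n → ℕ) → Set
Potential {n} F φ = ∀ e → F e ≡ true →
  φ (proj₂ (ends e)) ≤ φ (proj₁ (ends e)) + c₂ e × φ (proj₁ (ends e)) ≤ φ (proj₂ (ends e)) + c₂ e

module Relaxation {n : ℕ} (F : EdgeSet n) (k : ℕ) (u v : Vertex n) where

  arrival : Edge n → Vertex n → Vertex n → Maybe ℕ
  arrival e x y = if ⌊ y ≟V v ⌋ then addM (walkDist F k u x) (c₂ e) else nothing

  relax : Edge n → Maybe ℕ → Maybe ℕ
  relax e acc = if F e then minM acc (minM (arrival e (proj₁ (ends e)) (proj₂ (ends e)))
                                           (arrival e (proj₂ (ends e)) (proj₁ (ends e))))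
                       else acc

  -- The left-hand side of step≗relax is the step function local to walkDist, which cannot be
  -- named; walkDist-suc determines it by unification, hence the mutual block.
  mutual
    walkDist-suc : walkDist F (suc k) u v ≡ foldr relax (walkDist F k u v) (allEdges n)
    walkDist-suc = foldr-cong step≗relax refl (allEdges n)

    step≗relax : ∀ e acc → _ ≡ relax e acc
    step≗relax e acc with F e
    ... | true  = refl
    ... | false = refl

  relax-any : ∀ {w} e {acc} → Any (_≤ w) acc → Any (_≤ w) (relax e acc)
  relax-any e h with F e
  ... | true  = minM-anyˡ _ h
  ... | false = h

  arrival-any : ∀ {w} e x → Any (_≤ w) (walkDist F k u x) → Any (_≤ c₂ e + w) (arrival e x v)
  arrival-any e x h with v ≟V v
  ... | yes _  = addM-any (c₂ e) h
  ... | no v≢v = ⊥-elim (v≢v refl)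

  relax-fwd-any : ∀ {w} e acc → F e ≡ true →
                  Any (_≤ w) (arrival e (proj₁ (ends e)) (proj₂ (ends e))) → Any (_≤ w) (relax e acc)
  relax-fwd-any e acc Fe h rewrite Fe = minM-anyʳ acc (minM-anyˡ _ h)

  relax-bwd-any : ∀ {w} e acc → F e ≡ true →
                  Any (_≤ w) (arrival e (proj₂ (ends e)) (proj₁ (ends e))) → Any (_≤ w) (relax e acc)
  relax-bwd-any e acc Fe h rewrite Fe = minM-anyʳ acc (minM-anyʳ _ h)

  module _ (φ : Vertex n → ℕ) (φ-bound : ∀ x → All (λ d → φ x ≤ φ u + d) (walkDist F k u x)) where

    arrival-all : ∀ e x y → φ y ≤ φ x + c₂ e → All (λ d → φ v ≤ φ u + d) (arrival e x y)
    arrival-all e x y φy≤ with y ≟V v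
    ... | yes refl = addM-all (c₂ e) φy≤φu+d+c (φ-bound x)
      where
      φy≤φu+d+c : ∀ {d} → φ x ≤ φ u + d → φ y ≤ φ u + (d + c₂ e)
      φy≤φu+d+c {d} φx≤ = ℕ.≤-trans φy≤ (ℕ.≤-trans (ℕ.+-monoˡ-≤ (c₂ e) φx≤)
                                                   (ℕ.≤-reflexive (ℕ.+-assoc (φ u) d (c₂ e))))
    ... | no _     = nothing

    relax-all : Potential F φ → ∀ e {acc} → All (λ d → φ v ≤ φ u + d) acc →
                All (λ d → φ v ≤ φ u + d) (relax e acc)
    relax-all pot e h with F e in Fe
    ... | true  = minM-all h (minM-all (arrival-all e _ _ (proj₁ (pot e Fe)))
                                       (arrival-all e _ _ (proj₂ (pot e Fe))))
    ... | false = h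

∈-allEdges : ∀ {n} (e : Edge n) → e ∈ allEdges n
∈-allEdges {suc m} (vw j)  = ∈-++⁺ˡ (∈-map⁺ vw (∈-allFin j))
∈-allEdges {suc m} (vv' j) = ∈-++⁺ʳ (map vw (allFin (suc m))) (∈-++⁺ˡ (∈-map⁺ vv' (∈-allFin j)))
∈-allEdges {suc m} (v'w j) =
  ∈-++⁺ʳ (map vw (allFin (suc m))) (∈-++⁺ʳ (map vv' (allFin (suc m)))
    (∈-++⁺ˡ (∈-map⁺ v'w (∈-allFin j))))
∈-allEdges {suc m} (wv j)  =
  ∈-++⁺ʳ (map vw (allFin (suc m))) (∈-++⁺ʳ (map vv' (allFin (suc m)))
    (∈-++⁺ʳ (map v'w (allFin (suc m))) (∈-++⁺ˡ (∈-map⁺ wv (∈-allFin j)))))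
∈-allEdges {suc m} st      =
  ∈-++⁺ʳ (map vw (allFin (suc m))) (∈-++⁺ʳ (map vv' (allFin (suc m)))
    (∈-++⁺ʳ (map v'w (allFin (suc m))) (∈-++⁺ʳ (map wv (allFin m)) (here refl))))

module _ {n : ℕ} {F : EdgeSet n} where

  walkDist-zero-any : ∀ u → Any (_≤ 0) (walkDist F 0 u u)
  walkDist-zero-any u with u ≟V u
  ... | yes _  = just z≤n
  ... | no u≢u = ⊥-elim (u≢u refl)

  walkDist-suc-any : ∀ {w} k u v → Any (_≤ w) (walkDist F k u v) → Any (_≤ w) (walkDist F (suc k) u v)
  walkDist-suc-any k u v h = subst (Any _) (sym walkDist-suc) (foldr-preserves relax-any h (allEdges n))
    where open Relaxation F k u v

  walkDist-fwd-any : ∀ {w} k u e → F e ≡ true → Any (_≤ w) (walkDist F k u (proj₁ (ends e))) →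
                     Any (_≤ c₂ e + w) (walkDist F (suc k) u (proj₂ (ends e)))
  walkDist-fwd-any k u e Fe h =
    subst (Any _) (sym walkDist-suc)
          (foldr-preserves-from relax-any (λ acc → relax-fwd-any e acc Fe (arrival-any e _ h))
                                (∈-allEdges e))
    where open Relaxation F k u (proj₂ (ends e))

  walkDist-bwd-any : ∀ {w} k u e → F e ≡ true → Any (_≤ w) (walkDist F k u (proj₂ (ends e))) →
                     Any (_≤ c₂ e + w) (walkDist F (suc k) u (proj₁ (ends e)))
  walkDist-bwd-any k u e Fe h =
    subst (Any _) (sym walkDist-suc)
          (foldr-preserves-from relax-any (λ acc → relax-bwd-any e acc Fe (arrival-any e _ h))
                                (∈-allEdges e))
    where open Relaxation F k u (proj₁ (ends e))

  walkDist-≤-weight : ∀ {u v} (p : Reach F u v) k → length p ≤ k →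
                      Any (_≤ weight p) (walkDist F k u v)
  walkDist-≤-weight {u} here zero    _ = walkDist-zero-any u
  walkDist-≤-weight {u} here (suc k) _ = walkDist-suc-any k u u (walkDist-≤-weight here k z≤n)
  walkDist-≤-weight {u} (fwd e Fe p) (suc k) (s≤s ℓ≤k) =
    walkDist-fwd-any k u e Fe (walkDist-≤-weight p k ℓ≤k)
  walkDist-≤-weight {u} (bwd e Fe p) (suc k) (s≤s ℓ≤k) =
    walkDist-bwd-any k u e Fe (walkDist-≤-weight p k ℓ≤k)

  walkDist-potential : ∀ {φ} → Potential F φ → ∀ k u v →
                       All (λ d → φ v ≤ φ u + d) (walkDist F k u v)
  walkDist-potential {φ} pot zero u v with u ≟V v
  ... | yes refl = just (ℕ.m≤m+n (φ u) 0)
  ... | no _     = nothing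
  walkDist-potential {φ} pot (suc k) u v =
    subst (All _) (sym walkDist-suc)
          (foldr-preserves (relax-all φ (walkDist-potential pot k u) pot)
                           (walkDist-potential pot k u v) (allEdges n))
    where open Relaxation F k u v

c₂-positive : ∀ {n} (e : Edge n) → 1 ≤ c₂ e
c₂-positive (vw j)  = ℕ.m^n>0 2 (suc (toℕ j))
c₂-positive (vv' j) = ℕ.m^n>0 2 (suc (toℕ j))
c₂-positive (v'w j) = ℕ.m^n>0 2 (suc (toℕ j))
c₂-positive (wv j)  = ℕ.≤-refl
c₂-positive st      = ℕ.≤-refl

≤1-potential : ∀ {n} {F : EdgeSet n} {φ : Vertex n → ℕ} → (∀ x → φ x ≤ 1) → Potential F φ
≤1-potential {φ = φ} φ≤1 e _ = ≤+c₂ (proj₂ (ends e)) (proj₁ (ends e)) , ≤+c₂ (proj₁ (ends e)) (proj₂ (ends e))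
  where
  ≤+c₂ : ∀ x y → φ x ≤ φ y + c₂ e
  ≤+c₂ x y = ℕ.≤-trans (φ≤1 x) (ℕ.≤-trans (c₂-positive e) (ℕ.m≤n+m _ _))

s t : ∀ {m} → Vertex (suc m)
s     = zero , vK
t {m} = fromℕ m , wK

away-from-s : ∀ {m} → Vertex (suc m) → ℕ
away-from-s (_ , v'K)    = 1
away-from-s (_ , wK)     = 1
away-from-s (zero , vK)  = 0
away-from-s (suc _ , vK) = 1

away-from-s≤1 : ∀ {m} (x : Vertex (suc m)) → away-from-s x ≤ 1
away-from-s≤1 (_ , v'K)    = ℕ.≤-refl
away-from-s≤1 (_ , wK)     = ℕ.≤-refl
away-from-s≤1 (zero , vK)  = z≤n
away-from-s≤1 (suc _ , vK) = ℕ.≤-refl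

dist-fullE-st : ∀ {m} → dist fullE (s {m}) t ≡ just 1
dist-fullE-st {m} =
  squeeze (walkDist-≤-weight {F = fullE} (fwd (st {m}) refl here) (3 * suc m) (s≤s z≤n))
          (walkDist-potential {F = fullE} {φ = away-from-s} (≤1-potential away-from-s≤1)
                              (3 * suc m) (s {m}) t)

-- Positions along the s–t path

offset : ∀ {k} → (Fin k → ℕ) → Fin k → ℕ
offset a zero    = 0
offset a (suc j) = suc (a zero + offset (tail a) j)

offset-suc : ∀ {k} (a : Fin (suc k) → ℕ) (j : Fin k) →
             offset a (suc j) ≡ suc (offset a (inject₁ j) + a (inject₁ j))
offset-suc a zero    = cong suc (ℕ.+-identityʳ (a zero))
offset-suc a (suc j) = begin
  suc (a zero + offset (tail a) (suc j))
    ≡⟨ cong (λ x → suc (a zero + x)) (offset-suc (tail a) j) ⟩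
  suc (a zero + suc (offset (tail a) (inject₁ j) + tail a (inject₁ j)))
    ≡⟨ cong suc (ℕ.+-suc (a zero) _) ⟩
  suc (suc (a zero + (offset (tail a) (inject₁ j) + tail a (inject₁ j))))
    ≡⟨ cong (λ x → suc (suc x)) (sym (ℕ.+-assoc (a zero) _ _)) ⟩
  suc (suc (a zero + offset (tail a) (inject₁ j)) + tail a (inject₁ j))
    ∎
  where open ≡-Reasoning

offset-last : ∀ {k} (a : Fin (suc k) → ℕ) → offset a (fromℕ k) + a (fromℕ k) ≡ sum a + k
offset-last {zero}  a = sym (trans (ℕ.+-identityʳ _) (ℕ.+-identityʳ _))
offset-last {suc k} a = begin
  suc (a zero + offset (tail a) (fromℕ k)) + tail a (fromℕ k)
    ≡⟨ cong suc (ℕ.+-assoc (a zero) _ _) ⟩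
  suc (a zero + (offset (tail a) (fromℕ k) + tail a (fromℕ k)))
    ≡⟨ cong (λ x → suc (a zero + x)) (offset-last (tail a)) ⟩
  suc (a zero + (sum (tail a) + k))
    ≡⟨ cong suc (sym (ℕ.+-assoc (a zero) _ _)) ⟩
  suc (a zero + sum (tail a) + k)
    ≡⟨ sym (ℕ.+-suc _ k) ⟩
  a zero + sum (tail a) + suc k
    ∎
  where open ≡-Reasoning

offset-+-mono : ∀ {k} (a : Fin (suc k) → ℕ) {i j} → i Fin.≤ j → offset a i + a i ≤ offset a j + a j
offset-+-mono a {i} = <-weakInduction-startingFrom (λ j → offset a i + a i ≤ offset a j + a j) ℕ.≤-refl
  (λ j ≤inject₁ → ℕ.≤-trans ≤inject₁ (ℕ.≤-trans (ℕ.n≤1+n _)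
                    (ℕ.≤-trans (ℕ.≤-reflexive (sym (offset-suc a j))) (ℕ.m≤m+n _ _))))

rank : Kind → ℕ
rank vK  = 0
rank v'K = 1
rank wK  = 2

rank≤2 : ∀ k → rank k ≤ 2
rank≤2 vK  = z≤n
rank≤2 v'K = s≤s z≤n
rank≤2 wK  = ℕ.≤-refl

pos : ∀ {n} → Vertex n → ℕ
pos (j , k) = rank k + toℕ j * 3

pos-≤-cases : ∀ {n} {i j : Fin n} {k₁ k₂} → pos (i , k₁) ≤ pos (j , k₂) →
              (i ≡ j × rank k₁ ≤ rank k₂) ⊎ toℕ i < toℕ j
pos-≤-cases {i = i} {j} {k₁} {k₂} le with ℕ.<-cmp (toℕ i) (toℕ j)
... | tri< i<j _ _ = inj₂ i<j
... | tri≈ _ i≡j _ with toℕ-injective i≡j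
...   | refl = inj₁ (refl , ℕ.+-cancelʳ-≤ (toℕ i * 3) (rank k₁) (rank k₂) le)
pos-≤-cases {i = i} {j} {k₁} {k₂} le | tri> _ _ j<i = ⊥-elim (ℕ.<⇒≱ j-block<i-block le)
  where
  open ℕ.≤-Reasoning
  j-block<i-block : rank k₂ + toℕ j * 3 < rank k₁ + toℕ i * 3
  j-block<i-block = begin-strict
    rank k₂ + toℕ j * 3  <⟨ ℕ.+-monoˡ-< (toℕ j * 3) (s≤s (rank≤2 k₂)) ⟩
    suc (toℕ j) * 3      ≤⟨ ℕ.*-monoˡ-≤ 3 j<i ⟩
    toℕ i * 3            ≤⟨ ℕ.m≤n+m _ (rank k₁) ⟩
    rank k₁ + toℕ i * 3  ∎

pos-≤-wK : ∀ {n} {i j : Fin n} k → toℕ i ≤ toℕ j → pos (i , k) ≤ pos (j , wK)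
pos-≤-wK k i≤j = ℕ.+-mono-≤ (rank≤2 k) (ℕ.*-monoˡ-≤ 3 i≤j)

-- Binary values

fromBits : ∀ {k} → (Fin k → Bool) → ℕ
fromBits {zero}  x = 0
fromBits {suc k} x = (if x zero then 1 else 0) + 2 * fromBits (tail x)

bit+double-injective : ∀ a b A B → (if a then 1 else 0) + 2 * A ≡ (if b then 1 else 0) + 2 * B →
                       a ≡ b × A ≡ B
bit+double-injective true  true  A B eq = refl , ℕ.*-cancelˡ-≡ A B 2 (ℕ.suc-injective eq)
bit+double-injective false false A B eq = refl , ℕ.*-cancelˡ-≡ A B 2 eq
bit+double-injective true  false A B eq = ⊥-elim (ℕ.even≢odd B A (sym eq))
bit+double-injective false true  A B eq = ⊥-elim (ℕ.even≢odd A B eq)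

fromBits-injective : ∀ {k} (x y : Fin k → Bool) → fromBits x ≡ fromBits y → ∀ i → x i ≡ y i
fromBits-injective x y eq zero    = proj₁ (bit+double-injective _ _ (fromBits (tail x)) (fromBits (tail y)) eq)
fromBits-injective x y eq (suc i) = fromBits-injective (tail x) (tail y)
  (proj₂ (bit+double-injective (x zero) (y zero) (fromBits (tail x)) (fromBits (tail y)) eq)) i

∑-scaled-bits : ∀ {k} c (x : Fin k → Bool) →
                sum (λ i → if x i then c * 2 ^ toℕ i else 0) ≡ c * fromBits x
∑-scaled-bits {zero}  c x = sym (ℕ.*-zeroʳ c)
∑-scaled-bits {suc k} c x = begin
  (if x zero then c * 1 else 0) + sum (λ i → if tail x i then c * (2 * 2 ^ toℕ i) else 0)
    ≡⟨ cong ((if x zero then c * 1 else 0) +_) (trans (sum-cong-≗ reassoc) (∑-scaled-bits (c * 2) (tail x))) ⟩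
  (if x zero then c * 1 else 0) + c * 2 * fromBits (tail x)
    ≡⟨ head-bit (x zero) ⟩
  c * ((if x zero then 1 else 0) + 2 * fromBits (tail x))
    ∎
  where
  open ≡-Reasoning
  reassoc : ∀ i → (if tail x i then c * (2 * 2 ^ toℕ i) else 0) ≡ (if tail x i then c * 2 * 2 ^ toℕ i else 0)
  reassoc i = cong (λ z → if tail x i then z else 0) (sym (ℕ.*-assoc c 2 (2 ^ toℕ i)))
  head-bit : ∀ b → (if b then c * 1 else 0) + c * 2 * fromBits (tail x) ≡
                   c * ((if b then 1 else 0) + 2 * fromBits (tail x))
  head-bit true  = trans (cong (c * 1 +_) (ℕ.*-assoc c 2 _)) (sym (ℕ.*-distribˡ-+ c 1 _))
  head-bit false = ℕ.*-assoc c 2 _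

vwCost : ∀ {m} → EdgeSet (suc m) → ℕ
vwCost S = sum (λ j → if S (vw j) then pow j else 0)

vwCost-injective : ∀ {m} (S S′ : EdgeSet (suc m)) → vwCost S ≡ vwCost S′ → ∀ j → S (vw j) ≡ S′ (vw j)
vwCost-injective S S′ eq = fromBits-injective (λ j → S (vw j)) (λ j → S′ (vw j))
  (ℕ.*-cancelˡ-≡ _ _ 2 (trans (sym (∑-scaled-bits 2 (λ j → S (vw j))))
                              (trans eq (∑-scaled-bits 2 (λ j → S′ (vw j))))))

-- Ratios and their maximum

fromℚᵘ-mono-≤ : ∀ {p q} → p ℚᵘ.≤ q → ℚ.fromℚᵘ p ℚ.≤ ℚ.fromℚᵘ q
fromℚᵘ-mono-≤ {p} {q} p≤q = ℚ.toℚᵘ-cancel-≤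
  (ℚᵘ.≤-respʳ-≃ (ℚᵘ.≃-sym (ℚ.toℚᵘ-fromℚᵘ q)) (ℚᵘ.≤-respˡ-≃ (ℚᵘ.≃-sym (ℚ.toℚᵘ-fromℚᵘ p)) p≤q))

fromℚᵘ-cancel-≤ : ∀ {p q} → ℚ.fromℚᵘ p ℚ.≤ ℚ.fromℚᵘ q → p ℚᵘ.≤ q
fromℚᵘ-cancel-≤ {p} {q} p≤q =
  ℚᵘ.≤-respʳ-≃ (ℚ.toℚᵘ-fromℚᵘ q) (ℚᵘ.≤-respˡ-≃ (ℚ.toℚᵘ-fromℚᵘ p) (ℚ.toℚᵘ-mono-≤ p≤q))

ℕ/-mono-≤ : ∀ a b c d → a * suc d ≤ b * suc c → ℤ.+ a ℚ./ suc c ℚ.≤ ℤ.+ b ℚ./ suc d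
ℕ/-mono-≤ a b c d ad≤bc = fromℚᵘ-mono-≤ {ℚᵘ.mkℚᵘ (ℤ.+ a) c} {ℚᵘ.mkℚᵘ (ℤ.+ b) d}
  (ℚᵘ.*≤* (subst₂ ℤ._≤_ (ℤ.pos-* a (suc d)) (ℤ.pos-* b (suc c)) (ℤ.+≤+ ad≤bc)))

ℕ/-cancel-≤ : ∀ a b c d → ℤ.+ a ℚ./ suc c ℚ.≤ ℤ.+ b ℚ./ suc d → a * suc d ≤ b * suc c
ℕ/-cancel-≤ a b c d a/c≤b/d with fromℚᵘ-cancel-≤ {ℚᵘ.mkℚᵘ (ℤ.+ a) c} {ℚᵘ.mkℚᵘ (ℤ.+ b) d} a/c≤b/d
... | ℚᵘ.*≤* ad≤bc = ℤ.drop‿+≤+ (subst₂ ℤ._≤_ (sym (ℤ.pos-* a (suc d))) (sym (ℤ.pos-* b (suc c))) ad≤bc)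

ratio-≤ : ∀ {D} x y → All (_≤ D) x → ratio x y ℚ.≤ ℤ.+ D ℚ./ 1
ratio-≤ {D} (just a) (just (suc c)) (just a≤D) =
  ℕ/-mono-≤ a D c 0 (ℕ.≤-trans (ℕ.≤-reflexive (ℕ.*-identityʳ a)) (ℕ.≤-trans a≤D (ℕ.m≤m*n D (suc c))))
ratio-≤ {D} (just a) (just zero) _ = ℕ/-mono-≤ 0 D 0 0 z≤n
ratio-≤ {D} (just a) nothing     _ = ℕ/-mono-≤ 0 D 0 0 z≤n
ratio-≤ {D} nothing  y           _ = ℕ/-mono-≤ 0 D 0 0 z≤n

foldr-⊔-≤ : ∀ {A : Set} (g : A → ℚ.ℚ) {B} → ℚ.0ℚ ℚ.≤ B → (∀ x → g x ℚ.≤ B) →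
            ∀ xs → foldr (λ x acc → g x ℚ.⊔ acc) ℚ.0ℚ xs ℚ.≤ B
foldr-⊔-≤ g {B} 0≤B g≤B = foldr-preserves {P = ℚ._≤ B} (λ x acc≤B → ℚ.⊔-lub (g≤B x) acc≤B) 0≤B

≤-foldr-⊔ : ∀ {A : Set} (g : A → ℚ.ℚ) {x xs} → x ∈ xs →
            g x ℚ.≤ foldr (λ y acc → g y ℚ.⊔ acc) ℚ.0ℚ xs
≤-foldr-⊔ g {x} = foldr-preserves-from {P = g x ℚ.≤_}
  (λ y ≤acc → ℚ.≤-trans ≤acc (ℚ.p≤q⊔p (g y) _)) (λ acc → ℚ.p≤p⊔q (g x) acc)

∈-allVertices : ∀ {n} (v : Vertex n) → v ∈ allVertices n
∈-allVertices (j , k) = ∈-cartesianProduct⁺ (∈-allFin j) (∈-allKinds k)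
  where
  ∈-allKinds : ∀ k → k ∈ allKinds
  ∈-allKinds vK  = here refl
  ∈-allKinds v'K = there (here refl)
  ∈-allKinds wK  = there (there (here refl))

st∈distinctPairs : ∀ {m} → (s {m} , t) ∈ distinctPairs (suc m)
st∈distinctPairs = ∈-filter⁺ (λ p → ¬? (proj₁ p ≟V proj₂ p))
                             (∈-cartesianProduct⁺ (∈-allVertices _) (∈-allVertices _)) (λ ())

-- A spanner containing all edges of cost c₁ = 0

module Spanner {m : ℕ} (S : EdgeSet (suc m)) (zero-cost⊆S : ∀ e → c₁ e ≡ ℤ.+ 0 → S e ≡ true) where

  detour block : Fin (suc m) → ℕ
  detour j = if S (vw j) then 0 else pow j
  block  j = pow j + detour j

  stLength : ℕ
  stLength = offset block (fromℕ m) + block (fromℕ m)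

  -- The s–t path of S reaches v_j at offset block j and w_j at offset block j + block j.
  -- The weight of an Advance walk from u to v is at most hi v ∸ lo u; lo and hi differ only at
  -- v_j′ when {v_j, w_j} ∈ S, as v_j′ is then off the path, entered from v_j and left towards
  -- w_j at cost pow j each. Its length is at most pos v ∸ pos u, so that dist, which relaxes
  -- only 3n rounds, finds it.
  lo hi : Vertex (suc m) → ℕ
  lo (j , vK)  = offset block j
  lo (j , v'K) = offset block j + detour j
  lo (j , wK)  = offset block j + block j
  hi (j , vK)  = offset block j
  hi (j , v'K) = offset block j + pow j
  hi (j , wK)  = offset block j + block j

  detour-≤ : ∀ j → detour j ≤ pow j
  detour-≤ j with S (vw j)
  ... | true  = z≤n
  ... | false = ℕ.≤-refl

  detour-vw : ∀ {j} → S (vw j) ≡ true → detour j ≡ 0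
  detour-vw {j} Svw = cong (λ b → if b then 0 else pow j) Svw

  detour-¬vw : ∀ {j} → S (vw j) ≡ false → detour j ≡ pow j
  detour-¬vw {j} ¬Svw = cong (λ b → if b then 0 else pow j) ¬Svw

  record Advance (u v : Vertex (suc m)) : Set where
    constructor advance
    field
      walk         : Reach S u v
      length-bound : length walk + pos u ≤ pos v
      weight-bound : weight walk + lo u ≤ hi v

  Advance-here : ∀ {u} → lo u ≤ hi u → Advance u u
  Advance-here lo≤hi = advance here ℕ.≤-refl lo≤hi

  Advance-edge : ∀ e → S e ≡ true →
                 1 + pos (proj₁ (ends e)) ≤ pos (proj₂ (ends e)) →
                 c₂ e + lo (proj₁ (ends e)) ≤ hi (proj₂ (ends e)) →
                 Advance (proj₁ (ends e)) (proj₂ (ends e))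
  Advance-edge e Se pos-step weight-step = advance (fwd e Se here) pos-step
    (subst (λ x → x + lo (proj₁ (ends e)) ≤ hi (proj₂ (ends e))) (sym (ℕ.+-identityʳ (c₂ e))) weight-step)

  Advance-++ : ∀ {u x v} → hi x ≤ lo x → Advance u x → Advance x v → Advance u v
  Advance-++ hi≤lo (advance p ℓp wp) (advance q ℓq wq) =
    advance (p ++ᴿ q) (cost-++-≤ _ p q ℓp ℕ.≤-refl ℓq) (cost-++-≤ c₂ p q wp hi≤lo wq)

  v-v′ : ∀ j → Advance (j , vK) (j , v'K)
  v-v′ j = Advance-edge (vv' j) (zero-cost⊆S _ refl) ℕ.≤-refl (ℕ.≤-reflexive (ℕ.+-comm (pow j) _))

  v′-w : ∀ j → Advance (j , v'K) (j , wK)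
  v′-w j = Advance-edge (v'w j) (zero-cost⊆S _ refl) ℕ.≤-refl
                        (ℕ.≤-reflexive (x∙yz≈y∙xz (pow j) _ (detour j)))

  v-w : ∀ j → Advance (j , vK) (j , wK)
  v-w j with S (vw j) in Svw
  ... | true  = Advance-edge (vw j) Svw (ℕ.n≤1+n _)
                  (ℕ.≤-trans (ℕ.≤-reflexive (ℕ.+-comm (pow j) _)) (ℕ.+-monoʳ-≤ (offset block j) (ℕ.m≤m+n _ _)))
  ... | false = Advance-++ (ℕ.+-monoʳ-≤ (offset block j) (ℕ.≤-reflexive (sym (detour-¬vw Svw))))
                           (v-v′ j) (v′-w j)

  w-v : ∀ j → Advance (inject₁ j , wK) (suc j , vK)
  w-v j = Advance-edge (wv j) (zero-cost⊆S _ refl)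
            (ℕ.≤-reflexive (cong (λ i → 3 + i * 3) (toℕ-inject₁ j)))
            (ℕ.≤-reflexive (sym (offset-suc block j)))

  within-block : ∀ j {k₁ k₂} → rank k₁ ≤ rank k₂ → Advance (j , k₁) (j , k₂)
  within-block j {vK}  {vK}  _ = Advance-here ℕ.≤-refl
  within-block j {vK}  {v'K} _ = v-v′ j
  within-block j {vK}  {wK}  _ = v-w j
  within-block j {v'K} {v'K} _ = Advance-here (ℕ.+-monoʳ-≤ (offset block j) (detour-≤ j))
  within-block j {v'K} {wK}  _ = v′-w j
  within-block j {wK}  {wK}  _ = Advance-here ℕ.≤-refl
  within-block j {v'K} {vK}  ()
  within-block j {wK}  {vK}  ()
  within-block j {wK}  {v'K} (s≤s ())

  AdvanceTo : Fin (suc m) → Set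
  AdvanceTo j = ∀ k u → pos u ≤ pos (j , k) → Advance u (j , k)

  advance-to : ∀ j → AdvanceTo j
  advance-to = <-weakInduction AdvanceTo from-block-zero from-next-block
    where
    from-block-zero : AdvanceTo zero
    from-block-zero k (i , k′) le with pos-≤-cases {i = i} {zero} {k′} {k} le
    ... | inj₁ (refl , r≤) = within-block zero r≤

    from-next-block : ∀ j → AdvanceTo (inject₁ j) → AdvanceTo (suc j)
    from-next-block j ih k (i , k′) le with pos-≤-cases {i = i} {suc j} {k′} {k} le
    ... | inj₁ (refl , r≤) = within-block (suc j) r≤
    ... | inj₂ i<1+j       =
      Advance-++ ℕ.≤-refl (Advance-++ ℕ.≤-refl (ih wK (i , k′) (pos-≤-wK k′ i≤j)) (w-v j))
                          (within-block (suc j) z≤n)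
      where
      i≤j : toℕ i ≤ toℕ (inject₁ j)
      i≤j = subst (toℕ i ≤_) (sym (toℕ-inject₁ j)) (s≤s⁻¹ i<1+j)

  pos-≤-3n : ∀ (v : Vertex (suc m)) → pos v ≤ 3 * suc m
  pos-≤-3n (j , k) = begin
    pos (j , k)         ≤⟨ pos-≤-wK k (≤fromℕ j) ⟩
    pos (fromℕ m , wK)  ≡⟨ cong (λ i → 2 + i * 3) (toℕ-fromℕ m) ⟩
    2 + m * 3           ≤⟨ ℕ.n≤1+n _ ⟩
    suc m * 3           ≡⟨ ℕ.*-comm (suc m) 3 ⟩
    3 * suc m           ∎
    where open ℕ.≤-Reasoning

  hi-≤-stLength : ∀ v → hi v ≤ stLength
  hi-≤-stLength (j , k) = ℕ.≤-trans (hi-≤-end k) (offset-+-mono block (≤fromℕ j))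
    where
    hi-≤-end : ∀ k → hi (j , k) ≤ offset block j + block j
    hi-≤-end vK  = ℕ.m≤m+n _ _
    hi-≤-end v'K = ℕ.+-monoʳ-≤ (offset block j) (ℕ.m≤m+n _ _)
    hi-≤-end wK  = ℕ.≤-refl

  ShortWalk : Vertex (suc m) → Vertex (suc m) → Set
  ShortWalk u v = Σ (Reach S u v) (λ p → length p ≤ 3 * suc m × weight p ≤ stLength)

  Advance⇒ShortWalk : ∀ {u v} → Advance u v → ShortWalk u v
  Advance⇒ShortWalk {u} {v} (advance p ℓ-bound w-bound) =
    p , ℕ.≤-trans (ℕ.m≤m+n _ (pos u)) (ℕ.≤-trans ℓ-bound (pos-≤-3n v))
      , ℕ.≤-trans (ℕ.m≤m+n _ (lo u)) (ℕ.≤-trans w-bound (hi-≤-stLength v))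

  ShortWalk-sym : ∀ {u v} → ShortWalk u v → ShortWalk v u
  ShortWalk-sym (p , ℓ≤ , w≤) = reverse p , subst (_≤ 3 * suc m) (sym (cost-reverse _ p)) ℓ≤
                                          , subst (_≤ stLength) (sym (cost-reverse c₂ p)) w≤

  short-walk : ∀ u v → ShortWalk u v
  short-walk u v with ℕ.≤-total (pos u) (pos v)
  ... | inj₁ u≤v = Advance⇒ShortWalk (advance-to _ _ u u≤v)
  ... | inj₂ v≤u = ShortWalk-sym (Advance⇒ShortWalk (advance-to _ _ v v≤u))

  dist-≤-stLength : ∀ u v → Any (_≤ stLength) (dist S u v)
  dist-≤-stLength u v with short-walk u v
  ... | p , ℓ≤ , w≤ = Any.map (λ d≤ → ℕ.≤-trans d≤ w≤) (walkDist-≤-weight p (3 * suc m) ℓ≤)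

  hi-potential : S st ≡ false → Potential S hi
  hi-potential st∉S (vw j) Svw =
    ℕ.+-monoʳ-≤ (offset block j) (ℕ.≤-reflexive (trans (cong (pow j +_) (detour-vw Svw)) (ℕ.+-identityʳ _))) ,
    ℕ.≤-trans (ℕ.m≤m+n _ _) (ℕ.m≤m+n _ _)
  hi-potential st∉S (vv' j) _ = ℕ.≤-refl , ℕ.≤-trans (ℕ.m≤m+n _ _) (ℕ.m≤m+n _ _)
  hi-potential st∉S (v'w j) _ =
    ℕ.≤-trans (ℕ.+-monoʳ-≤ (offset block j) (ℕ.+-monoʳ-≤ (pow j) (detour-≤ j)))
              (ℕ.≤-reflexive (sym (ℕ.+-assoc (offset block j) (pow j) (pow j)))) ,
    ℕ.≤-trans (ℕ.+-monoʳ-≤ (offset block j) (ℕ.m≤m+n _ _)) (ℕ.m≤m+n _ _)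
  hi-potential st∉S (wv j) _ =
    ℕ.≤-reflexive (trans (offset-suc block j) (ℕ.+-comm 1 _)) ,
    ℕ.≤-trans (ℕ.n≤1+n _) (ℕ.≤-trans (ℕ.≤-reflexive (sym (offset-suc block j))) (ℕ.m≤m+n _ 1))
  hi-potential st∉S st Sst with trans (sym Sst) st∉S
  ... | ()

  dist-st : S st ≡ false → dist S s t ≡ just stLength
  dist-st st∉S =
    squeeze (dist-≤-stLength s t) (walkDist-potential {φ = hi} (hi-potential st∉S) (3 * suc m) s t)

  f₂-≡ : S st ≡ false → f₂ S ≡ ℤ.+ stLength ℚ./ 1
  f₂-≡ st∉S = ℚ.≤-antisym
    (foldr-⊔-≤ pairRatio (ratio-≤ {stLength} nothing nothing nothing)
               (λ (u , v) → ratio-≤ {stLength} _ _ (All.fromAny (dist-≤-stLength u v)))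
               (distinctPairs (suc m)))
    (subst (ℚ._≤ f₂ S) (cong₂ ratio (dist-st st∉S) (dist-fullE-st {m}))
           (≤-foldr-⊔ pairRatio (st∈distinctPairs {m})))
    where
    pairRatio : Vertex (suc m) × Vertex (suc m) → ℚ.ℚ
    pairRatio (u , v) = ratio (dist S u v) (dist fullE u v)

  vwCost+stLength : vwCost S + stLength ≡ sum (λ (j : Fin (suc m)) → pow j + pow j) + m
  vwCost+stLength = begin
    vwCost S + stLength                            ≡⟨ cong (vwCost S +_) (offset-last block) ⟩
    vwCost S + (sum block + m)                     ≡⟨ sym (ℕ.+-assoc (vwCost S) _ m) ⟩
    vwCost S + sum block + m                       ≡⟨ cong (_+ m) (sym (∑-distrib-+ selected block)) ⟩
    sum (λ j → selected j + block j) + m           ≡⟨ cong (_+ m) (sum-cong-≗ selected+block) ⟩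
    sum (λ (j : Fin (suc m)) → pow j + pow j) + m  ∎
    where
    open ≡-Reasoning
    selected : Fin (suc m) → ℕ
    selected j = if S (vw j) then pow j else 0
    selected+block : ∀ j → selected j + block j ≡ pow j + pow j
    selected+block j with S (vw j)
    ... | true  = cong (pow j +_) (ℕ.+-identityʳ (pow j))
    ... | false = refl

  add₁ : Edge (suc m) → ℤ.ℤ → ℤ.ℤ
  add₁ e acc = if S e then c₁ e ℤ.+ acc else acc

  add₁-zero-cost : ∀ e → c₁ e ≡ ℤ.+ 0 → ∀ acc → add₁ e acc ≡ acc
  add₁-zero-cost e c₁≡0 acc with S e
  ... | true  = trans (cong (ℤ._+ acc) c₁≡0) (ℤ.+-identityˡ acc)
  ... | false = refl

  skip-zero-cost : ∀ {A : Set} (h : A → Edge (suc m)) → (∀ a → c₁ (h a) ≡ ℤ.+ 0) →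
                   ∀ z xs ys → foldr add₁ z (map h xs ++ ys) ≡ foldr add₁ z ys
  skip-zero-cost h c₁≡0 z []       ys = refl
  skip-zero-cost h c₁≡0 z (a ∷ xs) ys = trans (add₁-zero-cost (h a) (c₁≡0 a) _) (skip-zero-cost h c₁≡0 z xs ys)

  add₁-vw : ∀ j a z → add₁ (vw j) (ℤ.+ a ℤ.+ z) ≡ ℤ.+ ((if S (vw j) then pow j else 0) + a) ℤ.+ z
  add₁-vw j a z with S (vw j)
  ... | true  = trans (sym (ℤ.+-assoc (ℤ.+ pow j) (ℤ.+ a) z)) (cong (ℤ._+ z) (sym (ℤ.pos-+ (pow j) a)))
  ... | false = refl

  add₁-vws : ∀ {k} (f : Fin k → Fin (suc m)) z →
             foldr add₁ z (map vw (tabulate f)) ≡ ℤ.+ sum (λ i → if S (vw (f i)) then pow (f i) else 0) ℤ.+ z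
  add₁-vws {zero}  f z = sym (ℤ.+-identityˡ z)
  add₁-vws {suc k} f z = trans (cong (add₁ (vw (f zero))) (add₁-vws (tail f) z)) (add₁-vw (f zero) _ z)

  f₁-≡ : S st ≡ false → f₁ S ≡ ℤ.+ vwCost S
  f₁-≡ st∉S = begin
    foldr add₁ (ℤ.+ 0) (vws ++ rest)          ≡⟨ foldr-++ add₁ (ℤ.+ 0) vws rest ⟩
    foldr add₁ (foldr add₁ (ℤ.+ 0) rest) vws  ≡⟨ cong (λ z → foldr add₁ z vws) rest-vanishes ⟩
    foldr add₁ (ℤ.+ 0) vws                    ≡⟨ add₁-vws (λ j → j) (ℤ.+ 0) ⟩
    ℤ.+ vwCost S ℤ.+ ℤ.+ 0                    ≡⟨ ℤ.+-identityʳ _ ⟩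
    ℤ.+ vwCost S                              ∎
    where
    open ≡-Reasoning
    vws rest : List (Edge (suc m))
    vws  = map vw (allFin (suc m))
    rest = map vv' (allFin (suc m)) ++ map v'w (allFin (suc m)) ++ map wv (allFin m) ++ st ∷ []
    rest-vanishes : foldr add₁ (ℤ.+ 0) rest ≡ ℤ.+ 0
    rest-vanishes =
      trans (skip-zero-cost vv' (λ _ → refl) _ (allFin (suc m)) _)
      (trans (skip-zero-cost v'w (λ _ → refl) _ (allFin (suc m)) _)
      (trans (skip-zero-cost wv (λ _ → refl) _ (allFin m) _)
             (cong (λ b → if b then c₁ (st {m}) ℤ.+ ℤ.+ 0 else ℤ.+ 0) st∉S)))

determined-by-vw : ∀ {m} {S S′ : EdgeSet (suc m)} → InX S → InX S′ →
                   (∀ j → S (vw j) ≡ S′ (vw j)) → ∀ e → S e ≡ S′ e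
determined-by-vw _             _               same-vw (vw j)  = same-vw j
determined-by-vw (_ , zc , _)  (_ , zc′ , _)   _       (vv' j) = trans (zc _ refl) (sym (zc′ _ refl))
determined-by-vw (_ , zc , _)  (_ , zc′ , _)   _       (v'w j) = trans (zc _ refl) (sym (zc′ _ refl))
determined-by-vw (_ , zc , _)  (_ , zc′ , _)   _       (wv j)  = trans (zc _ refl) (sym (zc′ _ refl))
determined-by-vw (_ , _ , st∉) (_ , _ , st∉′) _       st      = trans (st∉ st refl) (sym (st∉′ st refl))

not-dominates : ∀ {m} {S S′ : EdgeSet (suc m)} → InX S → InX S′ → vwCost S ≢ vwCost S′ → ¬ Dominates S S′
not-dominates {m} {S} {S′} (_ , zc , st∉) (_ , zc′ , st∉′) costs≢ (_ , f₁≤ , f₂≤) = ℕ.<⇒≱ L′<L L≤L′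
  where
  module P  = Spanner S zc
  module P′ = Spanner S′ zc′
  cost< : vwCost S < vwCost S′
  cost< = ℕ.≤∧≢⇒< (ℤ.drop‿+≤+ (subst₂ ℤ._≤_ (P.f₁-≡ (st∉ st refl)) (P′.f₁-≡ (st∉′ st refl)) f₁≤)) costs≢
  L≤L′ : P.stLength ≤ P′.stLength
  L≤L′ = subst₂ _≤_ (ℕ.*-identityʳ _) (ℕ.*-identityʳ _) (ℕ/-cancel-≤ P.stLength P′.stLength 0 0
           (subst₂ ℚ._≤_ (P.f₂-≡ (st∉ st refl)) (P′.f₂-≡ (st∉′ st refl)) f₂≤))
  L′<L : P′.stLength < P.stLength
  L′<L = ℕ.+-cancelˡ-< (vwCost S) _ _ (begin-strict
    vwCost S + P′.stLength   <⟨ ℕ.+-monoˡ-< P′.stLength cost< ⟩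
    vwCost S′ + P′.stLength  ≡⟨ trans P′.vwCost+stLength (sym P.vwCost+stLength) ⟩
    vwCost S + P.stLength    ∎)
    where open ℕ.≤-Reasoning

-- The argument only needs n ≠ 0, which 2 ≤ n guarantees.
lemma4 : (n : ℕ) → 2 ≤ n → (S S' : EdgeSet n) → InX S → InX S'
       → ¬ ((e : Edge n) → S e ≡ S' e)
       → (f S ≢ f S') × ¬ Dominates S S' × ¬ Dominates S' S
lemma4 (suc m) _ S S′ S∈X@(_ , zc , st∉) S′∈X@(_ , zc′ , st∉′) S≢S′ =
  f≢ , not-dominates S∈X S′∈X costs≢ , not-dominates S′∈X S∈X (λ eq → costs≢ (sym eq))
  where
  costs≢ : vwCost S ≢ vwCost S′
  costs≢ eq = S≢S′ (determined-by-vw S∈X S′∈X (vwCost-injective S S′ eq))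
  f≢ : f S ≢ f S′
  f≢ fS≡fS′ = costs≢ (ℤ.+-injective (begin
    ℤ.+ vwCost S   ≡⟨ sym (Spanner.f₁-≡ S zc (st∉ st refl)) ⟩
    f₁ S           ≡⟨ cong proj₁ fS≡fS′ ⟩
    f₁ S′          ≡⟨ Spanner.f₁-≡ S′ zc′ (st∉′ st refl) ⟩
    ℤ.+ vwCost S′  ∎))
    where open ≡-Reasoning
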